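{- The classes of boundedly ambiguous, of finitely ambiguous, and of countably ambiguous tree languages are each closed under finite union and finite intersection.
   Context: A parity tree automaton (PTA) $\mathcal{A}=(Q,\Sigma,Q_I,\delta,\mathbb{C})$: $Q$ finite, $Q_I\subseteq Q$, $\delta\subseteq Q\times\Sigma\times Q\times Q$, $\mathbb{C}:Q\to\mathbb{N}$; a computation on a tree $t:\{l,r\}^*\to\Sigma$ is $\phi:\{l,r\}^*\to Q$ with $\phi(\epsilon)\in Q_I$ and $(\phi(v),t(v),\phi(vl),\phi(vr))\in\delta$ for all $v$, accepting if along every branch the maximal color occurring infinitely often is even; $ACC(\mathcal{A},t)$ is the set of accepting computations. A PTA is boundedly ambiguous if there is $k\in\mathbb{N}$ with $|ACC(\mathcal{A},t)|\le k$ for all $t$; finitely (countably) ambiguous if $ACC(\mathcal{A},t)$ is finite (countable) for all $t$. A tree language is boundedly (finitely, countably) ambiguous if it is accepted by a PTA with that property. -}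

module Defs where

open import Level using (0ℓ)
open import Data.Nat using (ℕ; zero; suc; _≤_)
open import Data.Fin using (Fin)
open import Data.Bool using (Bool; true)
open import Data.List using (List; []; _∷ʳ_)
open import Data.Product using (Σ; ∃; ∃-syntax; _×_; _,_; proj₁)
open import Relation.Binary.PropositionalEquality using (_≡_)
open import Function.Bundles using (_⇔_)

data Dir : Set where
  l r : Dir

Node : Set
Node = List Dir

Tree : ℕ → Set
Tree m = Node → Fin m

-- Parity tree automaton over alphabet Fin m, with state set Fin n.
-- Q_I and δ are given by their characteristic (Boolean) functions.
record PTA (m : ℕ) : Set where
  field
    n       : ℕ
    initial : Fin n → Bool
    δ       : Fin n → Fin m → Fin n → Fin n → Bool
    col     : Fin n → ℕ
open PTA public

data Even : ℕ → Set where
  even-zero : Even zero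
  even-ss   : ∀ {k} → Even k → Even (suc (suc k))

IsComputation : ∀ {m} (A : PTA m) (t : Tree m) → (Node → Fin (n A)) → Set
IsComputation A t φ =
  (initial A (φ []) ≡ true) ×
  (∀ v → δ A (φ v) (t v) (φ (v ∷ʳ l)) (φ (v ∷ʳ r)) ≡ true)

prefix : (ℕ → Dir) → ℕ → Node
prefix β zero    = []
prefix β (suc k) = prefix β k ∷ʳ β k

InfinitelyOften : (ℕ → ℕ) → ℕ → Set
InfinitelyOften s c = ∀ i → ∃[ j ] (i ≤ j × s j ≡ c)

EventuallyAtMost : (ℕ → ℕ) → ℕ → Set
EventuallyAtMost s c = ∃[ i ] (∀ j → i ≤ j → s j ≤ c)

ParityOK : (ℕ → ℕ) → Set
ParityOK s = ∃[ c ] (Even c × InfinitelyOften s c × EventuallyAtMost s c)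

IsAccepting : ∀ {m} (A : PTA m) → (Node → Fin (n A)) → Set
IsAccepting A φ = ∀ (β : ℕ → Dir) → ParityOK (λ k → col A (φ (prefix β k)))

-- ACC(A,t): accepting computations; two are identified when equal as functions
ACC : ∀ {m} → PTA m → Tree m → Set
ACC A t = Σ (Node → Fin (n A)) (λ φ → IsComputation A t φ × IsAccepting A φ)

SameComp : ∀ {m} (A : PTA m) (t : Tree m) → ACC A t → ACC A t → Set
SameComp A t a b = ∀ v → proj₁ a v ≡ proj₁ b v

InjectsInto : ∀ {m} (A : PTA m) (t : Tree m) (X : Set) → Set
InjectsInto A t X = Σ (ACC A t → X) (λ f → ∀ a b → f a ≡ f b → SameComp A t a b)

BoundedlyAmbiguous : ∀ {m} → PTA m → Set
BoundedlyAmbiguous A = ∃[ k ] (∀ t → InjectsInto A t (Fin k))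

FinitelyAmbiguous : ∀ {m} → PTA m → Set
FinitelyAmbiguous A = ∀ t → ∃[ k ] InjectsInto A t (Fin k)

CountablyAmbiguous : ∀ {m} → PTA m → Set
CountablyAmbiguous A = ∀ t → InjectsInto A t ℕ

Lang : ℕ → Set₁
Lang m = Tree m → Set

Accepts : ∀ {m} → PTA m → Tree m → Set
Accepts A t = ACC A t

Recognizes : ∀ {m} → PTA m → Lang m → Set
Recognizes A L = ∀ t → L t ⇔ Accepts A t

BALang FALang CALang : ∀ {m} → Lang m → Set
BALang L = ∃[ A ] (Recognizes A L × BoundedlyAmbiguous A)
FALang L = ∃[ A ] (Recognizes A L × FinitelyAmbiguous A)
CALang L = ∃[ A ] (Recognizes A L × CountablyAmbiguous A)

⋃ ⋂ : ∀ {m k} → (Fin k → Lang m) → Lang m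
⋃ L t = ∃[ i ] L i t
⋂ L t = ∀ i → L i t

ClosedUnderFiniteUnionIntersection : (∀ {m} → Lang m → Set) → Set₁
ClosedUnderFiniteUnionIntersection P =
  ∀ (m k : ℕ) (L : Fin k → Lang m) → (∀ i → P (L i)) →
  P (⋃ L) × P (⋂ L)

-- The union of two automata is their disjoint union: a run never leaves the component of its root,
-- so the accepting runs of A₁ ∪ A₂ on t are those of A₁ and those of A₂, tagged.
--
-- The intersection runs A₁ and A₂ in parallel, together with a deterministic memory (a latest
-- appearance record): for every colour x it stores the largest colour of A₂ seen since A₁ last produced
-- a colour ≥ x. Reading the memory at the current colour a of A₁ gives a value v, and the pair (a, v),
-- coded lexicographically with a parity bit, is the colour of the product. Along a branch whose
-- A₁-colours have limsup p and A₂-colours limsup q, the product colours have limsup (p, q), so the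
-- product accepts exactly when both components do. As the memory is determined by the component runs,
-- accepting runs of A₁ ∩ A₂ correspond injectively to pairs of accepting runs.
--
-- Hence ACC(A₁ ∪ A₂, t) injects into ACC(A₁, t) ⊎ ACC(A₂, t) and ACC(A₁ ∩ A₂, t) into
-- ACC(A₁, t) × ACC(A₂, t), which preserves the bounds k₁ + k₂ and k₁ k₂, finiteness and countability.
-- Finite families follow by induction, from the empty and the universal automaton. Excluded middle
-- provides the limsup of a bounded sequence.
module Submission where

open import Defs
open import Level using (0ℓ)
open import Axiom.ExcludedMiddle using (ExcludedMiddle)
open import Axiom.DoubleNegationElimination using (em⇒dne)
open import Data.Bool using (Bool; true; false; if_then_else_)
import Data.Bool.Properties as Bool
open import Data.Empty using (⊥-elim)
open import Data.Fin using (Fin; zero; suc; toℕ)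
open import Data.Fin.Properties
  using (toℕ-fromℕ<; toℕ≤pred[n]; ¬Fin0; 1↔⊤; +↔⊎; *↔×; ⊎⇔∃; ∀-cons-⇔)
import Data.Fin.Properties as Fin
open import Data.List using (List; []; _∷_; _∷ʳ_; _++_)
open import Data.List.Properties using (++-identityʳ; ∷ʳ-++)
open import Data.List.Reverse using (Reverse; reverseView; []; _∶_∶ʳ_)
open import Data.Nat
  using (ℕ; zero; suc; _+_; _*_; _^_; _≤_; _<_; _⊔_; z≤n; s≤s; _≟_; _≤?_;
         _≤′_; ≤′-refl; ≤′-step; _≤‴_; ≤‴-refl; ≤‴-step)
open import Data.Nat.DivMod using (_mod_; m<n⇒m%n≡m)
open import Data.Nat.Properties
open import Data.Product using (Σ; ∃; ∃-syntax; _×_; _,_; proj₁; proj₂; uncurry)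
import Data.Product as Product
open import Data.Product.Function.NonDependent.Propositional using (_×-↔_; _×-⇔_)
open import Data.Product.Relation.Binary.Pointwise.NonDependent using () renaming (Pointwise to Pointwise×)
open import Data.Sum using (_⊎_; inj₁; inj₂; [_,_])
import Data.Sum as Sum
open import Data.Sum.Function.Propositional using (_⊎-⇔_)
open import Data.Sum.Properties using (inj₁-injective; inj₂-injective)
open import Data.Sum.Relation.Binary.Pointwise using (Pointwise; inj₁; inj₂)
open import Data.Unit using (⊤; tt)
open import Data.Vec using (Vec; []; _∷_; lookup; tabulate; replicate; uncons)
open import Data.Vec.Properties using (lookup∘tabulate; ≡-dec)
open import Function.Base using (_∘_)
open import Function.Bundles using (_⇔_; mk⇔; Equivalence; _↔_; mk↔ₛ′; Inverse; _↣_; mk↣; Injection)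
open import Function.Construct.Composition using (_⇔-∘_; _↔-∘_; _↣-∘_)
open import Function.Construct.Symmetry using (⇔-sym)
open import Function.Definitions using (Injective)
open import Function.Properties.Inverse using (↔-refl; ↔-sym; ↔⇒↣)
open import Relation.Binary.Definitions using (tri<; tri≈; tri>)
open import Relation.Binary.PropositionalEquality hiding ([_])
open import Relation.Nullary using (¬_; Dec; yes; no; does; contradiction)
open import Relation.Nullary.Decidable using (map′; _×-dec_; dec-true; dec-false)
open import Relation.Unary using (Decidable)

IsLimsup : (ℕ → ℕ) → ℕ → Set
IsLimsup s c = InfinitelyOften s c × EventuallyAtMost s c

InfinitelyOften∧EventuallyAtMost⇒≤ : ∀ {s a b} → InfinitelyOften s a → EventuallyAtMost s b → a ≤ b
InfinitelyOften∧EventuallyAtMost⇒≤ io (i , below) =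
  let (j , i≤j , sj≡a) = io i in subst (_≤ _) sj≡a (below j i≤j)

limsup-unique : ∀ {s c c′} → IsLimsup s c → IsLimsup s c′ → c ≡ c′
limsup-unique (io , ea) (io′ , ea′) =
  ≤-antisym (InfinitelyOften∧EventuallyAtMost⇒≤ io ea′) (InfinitelyOften∧EventuallyAtMost⇒≤ io′ ea)

-- Either the bound recurs, or it is eventually avoided and can be lowered.
limsup-exists : ExcludedMiddle 0ℓ → ∀ {s} D → EventuallyAtMost s D → ∃ (IsLimsup s)
limsup-exists em zero (i , below) =
  0 , (λ k → k ⊔ i , m≤m⊔n k i , n≤0⇒n≡0 (below (k ⊔ i) (m≤n⊔m k i))) , (i , below)
limsup-exists em {s} (suc D) (i , below) with em {∃[ i′ ] (∀ j → i′ ≤ j → s j ≢ suc D)}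
... | yes (i′ , avoids) = limsup-exists em D (i ⊔ i′ , lowered)
  where
  lowered : ∀ j → i ⊔ i′ ≤ j → s j ≤ D
  lowered j le =
    ≤-pred (≤∧≢⇒< (below j (≤-trans (m≤m⊔n i i′) le)) (avoids j (≤-trans (m≤n⊔m i i′) le)))
... | no recurs = suc D , recurring , (i , below)
  where
  recurring : InfinitelyOften s (suc D)
  recurring k = em⇒dne em λ none → recurs (k , λ j k≤j sj≡ → none (j , k≤j , sj≡))

ParityOK-cong : ∀ {s s′} → s ≗ s′ → ParityOK s → ParityOK s′
ParityOK-cong s≗s′ (c , even , io , (i , below)) =
  c , even ,
  (λ k → let (j , k≤j , sj≡c) = io k in j , k≤j , trans (sym (s≗s′ j)) sj≡c) ,
  (i , λ j le → subst (_≤ c) (s≗s′ j) (below j le))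

Even? : Decidable Even
Even? zero          = yes even-zero
Even? (suc zero)    = no λ ()
Even? (suc (suc n)) = map′ even-ss (λ { (even-ss e) → e }) (Even? n)

Even-double : ∀ x → Even (2 * x)
Even-double zero    = even-zero
Even-double (suc x) rewrite *-suc 2 x = even-ss (Even-double x)

¬Even-double+1 : ∀ x → ¬ Even (2 * x + 1)
¬Even-double+1 zero ()
¬Even-double+1 (suc x) e with subst Even (cong (_+ 1) (*-suc 2 x)) e
... | even-ss e′ = ¬Even-double+1 x e′

parityBit : ∀ {P : Set} → Dec P → ℕ
parityBit (yes _) = 0
parityBit (no _)  = 1

parityBit≤1 : ∀ {P : Set} (P? : Dec P) → parityBit P? ≤ 1
parityBit≤1 (yes _) = z≤n
parityBit≤1 (no _)  = s≤s z≤n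

Even-double+parityBit : ∀ {P : Set} x (P? : Dec P) → Even (2 * x + parityBit P?) ⇔ P
Even-double+parityBit x (yes p) =
  mk⇔ (λ _ → p) (λ _ → subst Even (sym (+-identityʳ (2 * x))) (Even-double x))
Even-double+parityBit x (no ¬p) =
  mk⇔ (λ e → ⊥-elim (¬Even-double+1 x e)) (λ p → contradiction p ¬p)

double+bit-< : ∀ {x y b b′} → x < y → b ≤ 1 → 2 * x + b < 2 * y + b′
double+bit-< {x} {y} {b} {b′} x<y b≤1 = begin-strict
  2 * x + b    ≤⟨ +-monoʳ-≤ (2 * x) b≤1 ⟩
  2 * x + 1    ≡⟨ +-comm (2 * x) 1 ⟩
  suc (2 * x)  <⟨ n<1+n (suc (2 * x)) ⟩
  2 + 2 * x    ≡⟨ sym (*-suc 2 x) ⟩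
  2 * suc x    ≤⟨ *-monoʳ-≤ 2 x<y ⟩
  2 * y        ≤⟨ m≤m+n (2 * y) b′ ⟩
  2 * y + b′   ∎
  where open ≤-Reasoning

-- The pair (a, v) with v ≤ D in lexicographic order, doubled to make room for a parity bit.
pairColour : ℕ → ℕ → ℕ → ℕ
pairColour D a v = 2 * (a * suc D + v) + parityBit (Even? a ×-dec Even? v)

Even-pairColour : ∀ D a v → Even (pairColour D a v) ⇔ (Even a × Even v)
Even-pairColour D a v = Even-double+parityBit (a * suc D + v) (Even? a ×-dec Even? v)

pairColour-<ˡ : ∀ {D a a′ v} v′ → v ≤ D → a < a′ → pairColour D a v < pairColour D a′ v′
pairColour-<ˡ {D} {a} {a′} {v} v′ v≤D a<a′ = double+bit-< code-< (parityBit≤1 _)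
  where
  open ≤-Reasoning
  code-< : a * suc D + v < a′ * suc D + v′
  code-< = begin-strict
    a * suc D + v      <⟨ +-monoʳ-< (a * suc D) (s≤s v≤D) ⟩
    a * suc D + suc D  ≡⟨ +-comm (a * suc D) (suc D) ⟩
    suc a * suc D      ≤⟨ *-monoˡ-≤ (suc D) a<a′ ⟩
    a′ * suc D         ≤⟨ m≤m+n (a′ * suc D) v′ ⟩
    a′ * suc D + v′    ∎

pairColour-monoʳ : ∀ D a {v v′} → v ≤ v′ → pairColour D a v ≤ pairColour D a v′
pairColour-monoʳ D a {v} {v′} v≤v′ with v ≟ v′
... | yes refl = ≤-refl
... | no v≢v′  = <⇒≤ (double+bit-< (+-monoʳ-< (a * suc D) (≤∧≢⇒< v≤v′ v≢v′)) (parityBit≤1 _))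

-- Merging two parity conditions

persist-until : ∀ {P Q : ℕ → Set} → Decidable Q → (∀ {j} → P j → ¬ Q j → P (suc j)) →
                ∀ {j k} → j ≤‴ k → P j → Q k → ∃[ j′ ] (j ≤ j′ × P j′ × Q j′)
persist-until Q? keep {j} ≤‴-refl       Pj Qk = j , ≤-refl , Pj , Qk
persist-until Q? keep {j} (≤‴-step j<k) Pj Qk with Q? j
... | yes Qj = j , ≤-refl , Pj , Qj
... | no ¬Qj =
  let (j′ , 1+j≤j′ , Pj′ , Qj′) = persist-until Q? keep j<k (keep Pj ¬Qj) Qk
  in j′ , ≤-trans (n≤1+n j) 1+j≤j′ , Pj′ , Qj′

-- g j x is the largest second colour seen since the first colour last reached x.
module LatestRecord
  (D : ℕ) (c₁ c₂ : ℕ → ℕ) (g : ℕ → ℕ → ℕ)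
  (c₁≤D : ∀ j → c₁ j ≤ D) (c₂≤D : ∀ j → c₂ j ≤ D) (g≤D : ∀ j x → g j x ≤ D)
  (g-reset : ∀ j {x} → x ≤ D → x ≤ c₁ j → g (suc j) x ≡ 0)
  (g-accumulate : ∀ j {x} → x ≤ D → c₁ j < x → g (suc j) x ≡ g j x ⊔ c₂ j)
  where

  merged : ℕ → ℕ
  merged j = pairColour D (c₁ j) (g j (c₁ j) ⊔ c₂ j)

  merged-at : ∀ {j a} → c₁ j ≡ a → merged j ≡ pairColour D a (g j a ⊔ c₂ j)
  merged-at refl = refl

  module Tail {p q N₁ N₂} (p-often : InfinitelyOften c₁ p) (c₁≤p : ∀ j → N₁ ≤ j → c₁ j ≤ p)
                          (q-often : InfinitelyOften c₂ q) (c₂≤q : ∀ j → N₂ ≤ j → c₂ j ≤ q) where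

    j₀ : ℕ
    j₀ = proj₁ (p-often (N₁ ⊔ N₂))

    c₁[j₀]≡p : c₁ j₀ ≡ p
    c₁[j₀]≡p = proj₂ (proj₂ (p-often (N₁ ⊔ N₂)))

    N₁⊔N₂≤j₀ : N₁ ⊔ N₂ ≤ j₀
    N₁⊔N₂≤j₀ = proj₁ (proj₂ (p-often (N₁ ⊔ N₂)))

    c₁-tail : ∀ {j} → j₀ ≤ j → c₁ j ≤ p
    c₁-tail le = c₁≤p _ (≤-trans (m≤m⊔n N₁ N₂) (≤-trans N₁⊔N₂≤j₀ le))

    c₂-tail : ∀ {j} → j₀ ≤ j → c₂ j ≤ q
    c₂-tail le = c₂≤q _ (≤-trans (m≤n⊔m N₁ N₂) (≤-trans N₁⊔N₂≤j₀ le))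

    p≤D : p ≤ D
    p≤D = subst (_≤ D) c₁[j₀]≡p (c₁≤D j₀)

    -- The reset at j₀ empties the record at p, and afterwards only second colours ≤ q enter it.
    record-tail : ∀ {j} → j₀ ≤′ j → g (suc j) p ≤ q
    record-tail ≤′-refl = subst (_≤ q) (sym (g-reset j₀ p≤D (≤-reflexive (sym c₁[j₀]≡p)))) z≤n
    record-tail (≤′-step {j} le) with p ≤? c₁ (suc j)
    ... | yes p≤c = subst (_≤ q) (sym (g-reset (suc j) p≤D p≤c)) z≤n
    ... | no p≰c rewrite g-accumulate (suc j) p≤D (≰⇒> p≰c) =
      ⊔-lub (record-tail le) (c₂-tail (≤′⇒≤ (≤′-step le)))

    value-tail : ∀ {j} → j₀ < j → g j p ⊔ c₂ j ≤ q
    value-tail {suc j} (s≤s le) = ⊔-lub (record-tail (≤⇒≤′ le)) (c₂-tail (m≤n⇒m≤1+n le))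

    merged-eventually : EventuallyAtMost merged (pairColour D p q)
    merged-eventually = suc j₀ , bound
      where
      bound : ∀ j → j₀ < j → merged j ≤ pairColour D p q
      bound j late with c₁ j ≟ p
      ... | yes c≡p = ≤-trans (≤-reflexive (merged-at c≡p)) (pairColour-monoʳ D p (value-tail late))
      ... | no c≢p  =
        <⇒≤ (pairColour-<ˡ q (⊔-lub (g≤D j (c₁ j)) (c₂≤D j)) (≤∧≢⇒< (c₁-tail (<⇒≤ late)) c≢p))

    Catching : ℕ → Set
    Catching j = j₀ < j × q ≤ g j p ⊔ c₂ j

    -- While the first colour stays below p, the record at p only grows.
    catching-persists : ∀ {j} → Catching j → c₁ j ≢ p → Catching (suc j)
    catching-persists {j} (late , q≤) c≢p =
      m≤n⇒m≤1+n late ,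
      ≤-trans q≤ (≤-trans (≤-reflexive (sym (g-accumulate j p≤D (≤∧≢⇒< (c₁-tail (<⇒≤ late)) c≢p))))
                          (m≤m⊔n (g (suc j) p) (c₂ (suc j))))

    merged-often : InfinitelyOften merged (pairColour D p q)
    merged-often i =
      let (j₁ , i⊔j₀<j₁ , c₂[j₁]≡q) = q-often (i ⊔ suc j₀)
          (j₂ , j₁≤j₂ , c₁[j₂]≡p)   = p-often j₁
          start = ≤-trans (m≤n⊔m i (suc j₀)) i⊔j₀<j₁ ,
                  subst (_≤ g j₁ p ⊔ c₂ j₁) c₂[j₁]≡q (m≤n⊔m (g j₁ p) (c₂ j₁))
          (j , j₁≤j , (late , q≤) , c₁[j]≡p) =
            persist-until (λ j → c₁ j ≟ p) catching-persists (≤⇒≤‴ j₁≤j₂) start c₁[j₂]≡p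
      in j , ≤-trans (m≤m⊔n i (suc j₀)) (≤-trans i⊔j₀<j₁ j₁≤j) ,
         trans (merged-at c₁[j]≡p) (cong (pairColour D p) (≤-antisym (value-tail late) q≤))

  limsup-merged : ∀ {p q} → IsLimsup c₁ p → IsLimsup c₂ q → IsLimsup merged (pairColour D p q)
  limsup-merged (p-often , (_ , c₁≤p)) (q-often , (_ , c₂≤q)) = merged-often , merged-eventually
    where open Tail p-often c₁≤p q-often c₂≤q

  ParityOK-merged : ParityOK c₁ → ParityOK c₂ → ParityOK merged
  ParityOK-merged (p , even-p , lim-p) (q , even-q , lim-q) =
    pairColour D p q , Equivalence.from (Even-pairColour D p q) (even-p , even-q) , limsup-merged lim-p lim-q

  ParityOK-merged⁻ : ExcludedMiddle 0ℓ → ParityOK merged → ParityOK c₁ × ParityOK c₂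
  ParityOK-merged⁻ em (c , even-c , lim-c) =
    let (p , lim-p) = limsup-exists em D (0 , λ j _ → c₁≤D j)
        (q , lim-q) = limsup-exists em D (0 , λ j _ → c₂≤D j)
        (even-p , even-q) = Equivalence.to (Even-pairColour D p q)
                              (subst Even (limsup-unique lim-c (limsup-merged lim-p lim-q)) even-c)
    in (p , even-p , lim-p) , (q , even-q , lim-q)

node-induction : (P : Node → Set) → P [] → (∀ v d → P v → P (v ∷ʳ d)) → ∀ v → P v
node-induction P root step v = from-view (reverseView v)
  where
  from-view : ∀ {v} → Reverse v → P v
  from-view []            = root
  from-view (v ∶ rv ∶ʳ d) = step v d (from-view rv)

module _ {M : Set} (start : M) (next : Node → M → M) where

  walk : M → Node → List Dir → M
  walk μ u []       = μ
  walk μ u (d ∷ ds) = walk (next u μ) (u ∷ʳ d) ds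

  along : Node → M
  along = walk start []

  walk-∷ʳ : ∀ μ u ds d → walk μ u (ds ∷ʳ d) ≡ next (u ++ ds) (walk μ u ds)
  walk-∷ʳ μ u []       d = cong (λ w → next w μ) (sym (++-identityʳ u))
  walk-∷ʳ μ u (x ∷ ds) d =
    trans (walk-∷ʳ (next u μ) (u ∷ʳ x) ds d)
          (cong (λ w → next w (walk (next u μ) (u ∷ʳ x) ds)) (∷ʳ-++ u x ds))

  along-∷ʳ : ∀ v d → along (v ∷ʳ d) ≡ next v (along v)
  along-∷ʳ v d = walk-∷ʳ start [] v d

module _ {m : ℕ} {S : Set} where

  IsRun : (S → Bool) → (S → Fin m → S → S → Bool) → Tree m → (Node → S) → Set
  IsRun init step t ψ =
    (init (ψ []) ≡ true) × (∀ v → step (ψ v) (t v) (ψ (v ∷ʳ l)) (ψ (v ∷ʳ r)) ≡ true)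

Accepting : ∀ {S : Set} → (S → ℕ) → (Node → S) → Set
Accepting κ ψ = ∀ β → ParityOK (λ k → κ (ψ (prefix β k)))

AccRuns : ∀ {m} {S : Set} → (S → Bool) → (S → Fin m → S → S → Bool) → (S → ℕ) → Tree m → Set
AccRuns {S = S} init step κ t = Σ (Node → S) (λ ψ → IsRun init step t ψ × Accepting κ ψ)

SameRun : ∀ {S : Set} {P : (Node → S) → Set} → Σ (Node → S) P → Σ (Node → S) P → Set
SameRun a b = proj₁ a ≗ proj₁ b

Reflects : {X Y : Set} → (X → X → Set) → (Y → Y → Set) → (X → Y) → Set
Reflects _≈_ _∼_ h = ∀ a b → h a ∼ h b → a ≈ b

IsRun-map : ∀ {m} {S T : Set} {initS stepS initT stepT} {t : Tree m} {ψ} (f : S → T) →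
  (∀ s → initS s ≡ true → initT (f s) ≡ true) →
  (∀ s a x y → stepS s a x y ≡ true → stepT (f s) a (f x) (f y) ≡ true) →
  IsRun initS stepS t ψ → IsRun initT stepT t (f ∘ ψ)
IsRun-map f init⇒ step⇒ (root , steps) = init⇒ _ root , λ v → step⇒ _ _ _ _ (steps v)

Accepting-map : ∀ {S T : Set} {κS κT} ψ (f : S → T) → (∀ s → κT (f s) ≡ κS s) →
  Accepting κS ψ → Accepting κT (f ∘ ψ)
Accepting-map ψ f κ≡ acc β = ParityOK-cong (λ k → sym (κ≡ _)) (acc β)

Accepting-cong : ∀ {S : Set} (κ : S → ℕ) {ψ ψ′} → ψ ≗ ψ′ → Accepting κ ψ → Accepting κ ψ′
Accepting-cong κ eq acc β = ParityOK-cong (λ k → cong κ (eq (prefix β k))) (acc β)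

module _ {m} {S : Set} (init : S → Bool) (step : S → Fin m → S → S → Bool) (t : Tree m) where

  IsRun-cong : ∀ {ψ ψ′} → ψ ≗ ψ′ → IsRun init step t ψ → IsRun init step t ψ′
  IsRun-cong {ψ} {ψ′} eq (root , steps) =
    subst (λ s → init s ≡ true) (eq []) root ,
    λ v → subst₂ (λ s x → step s (t v) x (ψ′ (v ∷ʳ r)) ≡ true) (eq v) (eq (v ∷ʳ l))
            (subst (λ y → step (ψ v) (t v) (ψ (v ∷ʳ l)) y ≡ true) (eq (v ∷ʳ r)) (steps v))

  run-invariant : ∀ {ψ} (P : S → Set) → (∀ s a x y → P s → step s a x y ≡ true → P x × P y) →
    IsRun init step t ψ → P (ψ []) → ∀ v → P (ψ v)
  run-invariant {ψ} P closed (_ , steps) root = node-induction (P ∘ ψ) root preserved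
    where
    preserved : ∀ v d → P (ψ v) → P (ψ (v ∷ʳ d))
    preserved v l Pv = proj₁ (closed _ _ _ _ Pv (steps v))
    preserved v r Pv = proj₂ (closed _ _ _ _ Pv (steps v))

module Restriction {m} {S T : Set} (init : S → Bool) (step : S → Fin m → S → S → Bool) (κ : S → ℕ)
  (ι : T → S) (closed : ∀ q a x y → step (ι q) a x y ≡ true → (∃[ x′ ] ι x′ ≡ x) × (∃[ y′ ] ι y′ ≡ y))
  {t : Tree m} where

  inside : (a : AccRuns init step κ t) → ∃[ q ] ι q ≡ proj₁ a [] → ∀ v → ∃[ q ] ι q ≡ proj₁ a v
  inside (_ , run , _) =
    run-invariant init step t (λ s → ∃[ q ] ι q ≡ s) (λ { _ a x y (q , refl) → closed q a x y }) run

  restrict-≗ : ∀ a root → proj₁ a ≗ ι ∘ (λ v → proj₁ (inside a root v))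
  restrict-≗ a root v = sym (proj₂ (inside a root v))

  restrict : (a : AccRuns init step κ t) → ∃[ q ] ι q ≡ proj₁ a [] →
    AccRuns (init ∘ ι) (λ q a x y → step (ι q) a (ι x) (ι y)) (κ ∘ ι) t
  restrict a@(_ , run , acc) root =
    (λ v → proj₁ (inside a root v)) ,
    IsRun-cong init step t (restrict-≗ a root) run , Accepting-cong κ (restrict-≗ a root) acc

module _ {m N} {S : Set} (e : S ↔ Fin N)
         (init : S → Bool) (step : S → Fin m → S → S → Bool) (κ : S → ℕ) where
  open Inverse e

  relabel : PTA m
  relabel = record
    { n = N ; initial = init ∘ from ; δ = λ q a x y → step (from q) a (from x) (from y) ; col = κ ∘ from }

  unrelabel : ∀ {t} → ACC relabel t → AccRuns init step κ t
  unrelabel (φ , run , acc) = from ∘ φ , run , acc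

  unrelabel-reflects : ∀ {t} → Reflects (SameComp relabel t) SameRun unrelabel
  unrelabel-reflects a b same v =
    trans (sym (strictlyInverseˡ _)) (trans (cong to (same v)) (strictlyInverseˡ _))

  ACC-relabel : ∀ {t} → ACC relabel t ⇔ AccRuns init step κ t
  ACC-relabel = mk⇔ unrelabel λ (ψ , run , acc) →
    to ∘ ψ ,
    IsRun-map {initT = initial relabel} {stepT = δ relabel} to init⇒ step⇒ run ,
    Accepting-map {κT = col relabel} ψ to (λ s → cong κ (strictlyInverseʳ s)) acc
    where
    init⇒ : ∀ s → init s ≡ true → init (from (to s)) ≡ true
    init⇒ s rewrite strictlyInverseʳ s = λ h → h
    step⇒ : ∀ s a x y → step s a x y ≡ true → step (from (to s)) a (from (to x)) (from (to y)) ≡ true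
    step⇒ s a x y rewrite strictlyInverseʳ s | strictlyInverseʳ x | strictlyInverseʳ y = λ h → h

InjectsInto-↣ : ∀ {m} {A : PTA m} {t X Y} → InjectsInto A t X → X ↣ Y → InjectsInto A t Y
InjectsInto-↣ (f , f-reflects) g =
  Injection.to g ∘ f , λ a b eq → f-reflects a b (Injection.injective g eq)

maxᶠ : ∀ {k} → (Fin k → ℕ) → ℕ
maxᶠ {zero}  f = 0
maxᶠ {suc k} f = f zero ⊔ maxᶠ (f ∘ suc)

≤-maxᶠ : ∀ {k} (f : Fin k → ℕ) i → f i ≤ maxᶠ f
≤-maxᶠ f zero    = m≤m⊔n (f zero) (maxᶠ (f ∘ suc))
≤-maxᶠ f (suc i) = ≤-trans (≤-maxᶠ (f ∘ suc) i) (m≤n⊔m (f zero) (maxᶠ (f ∘ suc)))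

Vec-0↔⊤ : ∀ {A : Set} → Vec A 0 ↔ ⊤
Vec-0↔⊤ = mk↔ₛ′ (λ _ → tt) (λ _ → []) (λ _ → refl) (λ { [] → refl })

Vec-suc↔× : ∀ {A : Set} {L} → Vec A (suc L) ↔ (A × Vec A L)
Vec-suc↔× = mk↔ₛ′ uncons (uncurry _∷_) (λ _ → refl) (λ { (_ ∷ _) → refl })

Vec↔Fin^ : ∀ k L → Vec (Fin k) L ↔ Fin (k ^ L)
Vec↔Fin^ k zero    = ↔-sym 1↔⊤ ↔-∘ Vec-0↔⊤
Vec↔Fin^ k (suc L) = ↔-sym *↔× ↔-∘ ((↔-refl ×-↔ Vec↔Fin^ k L) ↔-∘ Vec-suc↔×)

module Memory (D : ℕ) where

  Memory : Set
  Memory = Vec (Fin (suc D)) (suc D)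

  blank : Memory
  blank = replicate (suc D) zero

  read : Memory → ℕ → ℕ
  read μ x = toℕ (lookup μ (x mod suc D))

  updatedCell : ℕ → ℕ → Memory → Fin (suc D) → Fin (suc D)
  updatedCell a b μ i = if does (toℕ i ≤? a) then zero else (toℕ (lookup μ i) ⊔ b) mod suc D

  update : ℕ → ℕ → Memory → Memory
  update a b μ = tabulate (updatedCell a b μ)

  read≤D : ∀ μ x → read μ x ≤ D
  read≤D μ x = toℕ≤pred[n] (lookup μ (x mod suc D))

  toℕ-mod : ∀ {x} → x ≤ D → toℕ (x mod suc D) ≡ x
  toℕ-mod x≤D = trans (toℕ-fromℕ< _) (m<n⇒m%n≡m (s≤s x≤D))

  read-update-reset : ∀ {a b x} μ → x ≤ D → x ≤ a → read (update a b μ) x ≡ 0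
  read-update-reset {a} {b} {x} μ x≤D x≤a
    rewrite lookup∘tabulate (updatedCell a b μ) (x mod suc D) | toℕ-mod x≤D | dec-true (x ≤? a) x≤a
    = refl

  read-update-accumulate : ∀ {a b x} μ → x ≤ D → a < x → b ≤ D → read (update a b μ) x ≡ read μ x ⊔ b
  read-update-accumulate {a} {b} {x} μ x≤D a<x b≤D
    rewrite lookup∘tabulate (updatedCell a b μ) (x mod suc D) | toℕ-mod x≤D | dec-false (x ≤? a) (<⇒≱ a<x)
    = toℕ-mod (⊔-lub (read≤D μ x) b≤D)

-- Union

module Union {m} (A₁ A₂ : PTA m) where

  State : Set
  State = Fin (n A₁) ⊎ Fin (n A₂)

  init∪ : State → Bool
  init∪ = [ initial A₁ , initial A₂ ]

  step∪ : State → Fin m → State → State → Bool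
  step∪ (inj₁ q) a (inj₁ x) (inj₁ y) = δ A₁ q a x y
  step∪ (inj₂ q) a (inj₂ x) (inj₂ y) = δ A₂ q a x y
  step∪ _        _ _        _        = false

  colour∪ : State → ℕ
  colour∪ = [ col A₁ , col A₂ ]

  automaton : PTA m
  automaton = relabel (↔-sym +↔⊎) init∪ step∪ colour∪

  step∪-closed₁ : ∀ q a x y → step∪ (inj₁ q) a x y ≡ true → (∃[ x′ ] inj₁ x′ ≡ x) × (∃[ y′ ] inj₁ y′ ≡ y)
  step∪-closed₁ q a (inj₁ x) (inj₁ y) _ = (x , refl) , (y , refl)
  step∪-closed₁ q a (inj₁ x) (inj₂ y) ()
  step∪-closed₁ q a (inj₂ x) _        ()

  step∪-closed₂ : ∀ q a x y → step∪ (inj₂ q) a x y ≡ true → (∃[ x′ ] inj₂ x′ ≡ x) × (∃[ y′ ] inj₂ y′ ≡ y)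
  step∪-closed₂ q a (inj₂ x) (inj₂ y) _ = (x , refl) , (y , refl)
  step∪-closed₂ q a (inj₂ x) (inj₁ y) ()
  step∪-closed₂ q a (inj₁ x) _        ()

  module _ {t : Tree m} where

    Runs : Set
    Runs = AccRuns init∪ step∪ colour∪ t

    module Left  = Restriction init∪ step∪ colour∪ inj₁ step∪-closed₁ {t}
    module Right = Restriction init∪ step∪ colour∪ inj₂ step∪-closed₂ {t}

    split-at : (a : Runs) (s : State) → s ≡ proj₁ a [] → ACC A₁ t ⊎ ACC A₂ t
    split-at a (inj₁ q) root = inj₁ (Left.restrict a (q , root))
    split-at a (inj₂ q) root = inj₂ (Right.restrict a (q , root))

    split : Runs → ACC A₁ t ⊎ ACC A₂ t
    split a = split-at a (proj₁ a []) refl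

    split-at-reflects : ∀ a s e b s′ e′ →
      Pointwise (SameComp A₁ t) (SameComp A₂ t) (split-at a s e) (split-at b s′ e′) → SameRun a b
    split-at-reflects a (inj₁ q) e b (inj₁ q′) e′ (inj₁ same) v =
      trans (Left.restrict-≗ a (q , e) v) (trans (cong inj₁ (same v)) (sym (Left.restrict-≗ b (q′ , e′) v)))
    split-at-reflects a (inj₂ q) e b (inj₂ q′) e′ (inj₂ same) v =
      trans (Right.restrict-≗ a (q , e) v) (trans (cong inj₂ (same v)) (sym (Right.restrict-≗ b (q′ , e′) v)))

    split-reflects : Reflects SameRun (Pointwise (SameComp A₁ t) (SameComp A₂ t)) split
    split-reflects a b = split-at-reflects a _ refl b _ refl

    embed : ACC A₁ t ⊎ ACC A₂ t → Runs
    embed (inj₁ (φ , run , acc)) = inj₁ ∘ φ , run , acc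
    embed (inj₂ (φ , run , acc)) = inj₂ ∘ φ , run , acc

    ACC-∪ : ACC automaton t ⇔ (ACC A₁ t ⊎ ACC A₂ t)
    ACC-∪ = mk⇔ (split ∘ Equivalence.to ACC-relabel′) (Equivalence.from ACC-relabel′ ∘ embed)
      where ACC-relabel′ = ACC-relabel (↔-sym +↔⊎) init∪ step∪ colour∪

    InjectsInto-∪ : ∀ {X Y} → InjectsInto A₁ t X → InjectsInto A₂ t Y → InjectsInto automaton t (X ⊎ Y)
    InjectsInto-∪ (f , f-reflects) (g , g-reflects) =
      Sum.map f g ∘ split ∘ unrelabel (↔-sym +↔⊎) init∪ step∪ colour∪ ,
      λ a b → unrelabel-reflects (↔-sym +↔⊎) init∪ step∪ colour∪ a b ∘ split-reflects _ _ ∘ map-reflects _ _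
      where
      map-reflects : Reflects (Pointwise (SameComp A₁ t) (SameComp A₂ t)) _≡_ (Sum.map f g)
      map-reflects (inj₁ a) (inj₁ b) eq = inj₁ (f-reflects a b (inj₁-injective eq))
      map-reflects (inj₂ a) (inj₂ b) eq = inj₂ (g-reflects a b (inj₂-injective eq))

-- Intersection

does-true⇒ : ∀ {P : Set} (P? : Dec P) → does P? ≡ true → P
does-true⇒ (yes p) _ = p
does-true⇒ (no _)  ()

module Intersection {m} (A₁ A₂ : PTA m) where

  D : ℕ
  D = maxᶠ (col A₁) ⊔ maxᶠ (col A₂)

  open Memory D

  State : Set
  State = Fin (n A₁) × Fin (n A₂) × Memory

  enumeration : State ↔ Fin (n A₁ * (n A₂ * (suc D ^ suc D)))
  enumeration = ↔-sym *↔× ↔-∘ (↔-refl ×-↔ (↔-sym *↔× ↔-∘ (↔-refl ×-↔ Vec↔Fin^ (suc D) (suc D))))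

  col₁ col₂ : State → ℕ
  col₁ (q₁ , _ , _) = col A₁ q₁
  col₂ (_ , q₂ , _) = col A₂ q₂

  memory : State → Memory
  memory (_ , _ , μ) = μ

  next : State → Memory
  next s = update (col₁ s) (col₂ s) (memory s)

  Init : State → Set
  Init (q₁ , q₂ , μ) = initial A₁ q₁ ≡ true × initial A₂ q₂ ≡ true × μ ≡ blank

  Step : State → Fin m → State → State → Set
  Step s a (x₁ , x₂ , μˡ) (y₁ , y₂ , μʳ) =
    δ A₁ (proj₁ s) a x₁ y₁ ≡ true × δ A₂ (proj₁ (proj₂ s)) a x₂ y₂ ≡ true × μˡ ≡ next s × μʳ ≡ next s

  _≟ᴹ_ : (μ ν : Memory) → Dec (μ ≡ ν)
  _≟ᴹ_ = ≡-dec Fin._≟_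

  Init? : ∀ s → Dec (Init s)
  Init? (q₁ , q₂ , μ) = initial A₁ q₁ Bool.≟ true ×-dec initial A₂ q₂ Bool.≟ true ×-dec μ ≟ᴹ blank

  Step? : ∀ s a x y → Dec (Step s a x y)
  Step? s a (x₁ , x₂ , μˡ) (y₁ , y₂ , μʳ) =
    δ A₁ (proj₁ s) a x₁ y₁ Bool.≟ true ×-dec δ A₂ (proj₁ (proj₂ s)) a x₂ y₂ Bool.≟ true ×-dec
    μˡ ≟ᴹ next s ×-dec μʳ ≟ᴹ next s

  init∩ : State → Bool
  init∩ s = does (Init? s)

  step∩ : State → Fin m → State → State → Bool
  step∩ s a x y = does (Step? s a x y)

  colour∩ : State → ℕ
  colour∩ s = pairColour D (col₁ s) (read (memory s) (col₁ s) ⊔ col₂ s)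

  automaton : PTA m
  automaton = relabel enumeration init∩ step∩ colour∩

  col₁≤D : ∀ s → col₁ s ≤ D
  col₁≤D s = ≤-trans (≤-maxᶠ (col A₁) (proj₁ s)) (m≤m⊔n _ _)

  col₂≤D : ∀ s → col₂ s ≤ D
  col₂≤D s = ≤-trans (≤-maxᶠ (col A₂) (proj₁ (proj₂ s))) (m≤n⊔m _ _)

  module _ {t : Tree m} where

    Runs : Set
    Runs = AccRuns init∩ step∩ colour∩ t

    module OnRun {ψ : Node → State} (run : IsRun init∩ step∩ t ψ) where

      init-holds : Init (ψ [])
      init-holds = does-true⇒ (Init? (ψ [])) (proj₁ run)

      step-holds : ∀ v → Step (ψ v) (t v) (ψ (v ∷ʳ l)) (ψ (v ∷ʳ r))
      step-holds v = does-true⇒ (Step? (ψ v) (t v) (ψ (v ∷ʳ l)) (ψ (v ∷ʳ r))) (proj₂ run v)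

      memory-step : ∀ v d → memory (ψ (v ∷ʳ d)) ≡ next (ψ v)
      memory-step v l = proj₁ (proj₂ (proj₂ (step-holds v)))
      memory-step v r = proj₂ (proj₂ (proj₂ (step-holds v)))

      read-reset : ∀ v d {x} → x ≤ D → x ≤ col₁ (ψ v) → read (memory (ψ (v ∷ʳ d))) x ≡ 0
      read-reset v d {x} x≤D x≤c =
        trans (cong (λ μ → read μ x) (memory-step v d)) (read-update-reset (memory (ψ v)) x≤D x≤c)

      read-accumulate : ∀ v d {x} → x ≤ D → col₁ (ψ v) < x →
        read (memory (ψ (v ∷ʳ d))) x ≡ read (memory (ψ v)) x ⊔ col₂ (ψ v)
      read-accumulate v d {x} x≤D c<x =
        trans (cong (λ μ → read μ x) (memory-step v d))
              (read-update-accumulate (memory (ψ v)) x≤D c<x (col₂≤D (ψ v)))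

      run₁ : IsRun (initial A₁) (δ A₁) t (proj₁ ∘ ψ)
      run₁ = IsRun-map {ψ = ψ} proj₁ (λ s → proj₁ ∘ does-true⇒ (Init? s))
                       (λ s a x y → proj₁ ∘ does-true⇒ (Step? s a x y)) run

      run₂ : IsRun (initial A₂) (δ A₂) t (proj₁ ∘ proj₂ ∘ ψ)
      run₂ = IsRun-map {ψ = ψ} (proj₁ ∘ proj₂) (λ s → proj₁ ∘ proj₂ ∘ does-true⇒ (Init? s))
                       (λ s a x y → proj₁ ∘ proj₂ ∘ does-true⇒ (Step? s a x y)) run

      module Branch (β : ℕ → Dir) = LatestRecord D
        (λ k → col₁ (ψ (prefix β k))) (λ k → col₂ (ψ (prefix β k))) (λ k → read (memory (ψ (prefix β k))))
        (λ k → col₁≤D (ψ (prefix β k))) (λ k → col₂≤D (ψ (prefix β k)))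
        (λ k → read≤D (memory (ψ (prefix β k))))
        (λ k → read-reset (prefix β k) (β k)) (λ k → read-accumulate (prefix β k) (β k))

    split : ExcludedMiddle 0ℓ → Runs → ACC A₁ t × ACC A₂ t
    split em (ψ , run , acc) =
      (proj₁ ∘ ψ , run₁ , λ β → proj₁ (Branch.ParityOK-merged⁻ β em (acc β))) ,
      (proj₁ ∘ proj₂ ∘ ψ , run₂ , λ β → proj₂ (Branch.ParityOK-merged⁻ β em (acc β)))
      where open OnRun {ψ} run

    -- The memory is a function of the two component runs.
    split-reflects : (em : ExcludedMiddle 0ℓ) →
      Reflects SameRun (Pointwise× (SameComp A₁ t) (SameComp A₂ t)) (split em)
    split-reflects em (ψ , run , _) (ψ′ , run′ , _) (same₁ , same₂) v = same-state (same-memory v)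
      where
      same-state : ∀ {v} → memory (ψ v) ≡ memory (ψ′ v) → ψ v ≡ ψ′ v
      same-state {v} eq = cong₂ _,_ (same₁ v) (cong₂ _,_ (same₂ v) eq)
      same-memory : ∀ v → memory (ψ v) ≡ memory (ψ′ v)
      same-memory = node-induction (λ v → memory (ψ v) ≡ memory (ψ′ v))
        (trans (proj₂ (proj₂ (OnRun.init-holds {ψ} run))) (sym (proj₂ (proj₂ (OnRun.init-holds {ψ′} run′)))))
        λ v d eq → trans (OnRun.memory-step {ψ} run v d)
                     (trans (cong next (same-state eq)) (sym (OnRun.memory-step {ψ′} run′ v d)))

    merge : ACC A₁ t → ACC A₂ t → Runs
    merge (φ₁ , run₁ , acc₁) (φ₂ , run₂ , acc₂) = ψ , run , λ β → Branch.ParityOK-merged β (acc₁ β) (acc₂ β)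
      where
      ψ : Node → State
      ψ v = φ₁ v , φ₂ v , along blank (λ u → update (col A₁ (φ₁ u)) (col A₂ (φ₂ u))) v
      run : IsRun init∩ step∩ t ψ
      run = dec-true (Init? (ψ [])) (proj₁ run₁ , proj₁ run₂ , refl) ,
            λ v → dec-true (Step? (ψ v) (t v) (ψ (v ∷ʳ l)) (ψ (v ∷ʳ r)))
                    (proj₂ run₁ v , proj₂ run₂ v , along-∷ʳ _ _ v l , along-∷ʳ _ _ v r)
      open OnRun {ψ} run

    ACC-∩ : ExcludedMiddle 0ℓ → ACC automaton t ⇔ (ACC A₁ t × ACC A₂ t)
    ACC-∩ em = mk⇔ (split em ∘ Equivalence.to ACC-relabel′) (Equivalence.from ACC-relabel′ ∘ uncurry merge)
      where ACC-relabel′ = ACC-relabel enumeration init∩ step∩ colour∩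

    InjectsInto-∩ : ExcludedMiddle 0ℓ → ∀ {X Y} →
      InjectsInto A₁ t X → InjectsInto A₂ t Y → InjectsInto automaton t (X × Y)
    InjectsInto-∩ em (f , f-reflects) (g , g-reflects) =
      Product.map f g ∘ split em ∘ unrelabel′ ,
      λ a b → unrelabel-reflects enumeration init∩ step∩ colour∩ a b
              ∘ split-reflects em (unrelabel′ a) (unrelabel′ b) ∘ map-reflects _ _
      where
      unrelabel′ = unrelabel enumeration init∩ step∩ colour∩
      map-reflects : Reflects (Pointwise× (SameComp A₁ t) (SameComp A₂ t)) _≡_ (Product.map f g)
      map-reflects (a₁ , a₂) (b₁ , b₂) eq = f-reflects a₁ b₁ (cong proj₁ eq) , g-reflects a₂ b₂ (cong proj₂ eq)

_∪ᴬ_ _∩ᴬ_ : ∀ {m} → PTA m → PTA m → PTA m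
_∪ᴬ_ = Union.automaton
_∩ᴬ_ = Intersection.automaton

∅ᴬ : ∀ {m} → PTA m
∅ᴬ = record { n = 0 ; initial = λ () ; δ = λ () ; col = λ () }

universal : ∀ {m} → PTA m
universal = record { n = 1 ; initial = λ _ → true ; δ = λ _ _ _ _ → true ; col = λ _ → 0 }

¬ACC-∅ : ∀ {m} {t : Tree m} → ¬ ACC ∅ᴬ t
¬ACC-∅ (φ , _) = ¬Fin0 (φ [])

ACC-universal : ∀ {m} (t : Tree m) → ACC universal t
ACC-universal t =
  (λ _ → zero) , (refl , λ _ → refl) , λ β → 0 , even-zero , (λ i → i , ≤-refl , refl) , (0 , λ _ _ → z≤n)

InjectsInto-∅ : ∀ {m} (t : Tree m) {X} → InjectsInto ∅ᴬ t X
InjectsInto-∅ t = (λ a → ⊥-elim (¬ACC-∅ {t = t} a)) , λ a → ⊥-elim (¬ACC-∅ {t = t} a)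

InjectsInto-universal : ∀ {m} (t : Tree m) {X} → X → InjectsInto universal t X
InjectsInto-universal t x = (λ _ → x) , λ { (φ , _) (φ′ , _) _ v → Fin1-trivial (φ v) (φ′ v) }
  where
  Fin1-trivial : ∀ (i j : Fin 1) → i ≡ j
  Fin1-trivial zero zero = refl

triangle : ℕ → ℕ
triangle zero    = 0
triangle (suc k) = suc k + triangle k

triangle-mono-≤ : ∀ {j k} → j ≤ k → triangle j ≤ triangle k
triangle-mono-≤ {zero}          _         = z≤n
triangle-mono-≤ {suc j} {suc k} (s≤s j≤k) = +-mono-≤ (s≤s j≤k) (triangle-mono-≤ j≤k)

cantor : ℕ × ℕ → ℕ
cantor (a , b) = triangle (a + b) + a

cantor-< : ∀ {a b a′ b′} → a + b < a′ + b′ → cantor (a , b) < cantor (a′ , b′)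
cantor-< {a} {b} {a′} {b′} lt = begin-strict
  triangle (a + b) + a            ≤⟨ +-monoʳ-≤ (triangle (a + b)) (m≤m+n a b) ⟩
  triangle (a + b) + (a + b)      <⟨ +-monoʳ-< (triangle (a + b)) (n<1+n (a + b)) ⟩
  triangle (a + b) + suc (a + b)  ≡⟨ +-comm (triangle (a + b)) (suc (a + b)) ⟩
  triangle (suc (a + b))          ≤⟨ triangle-mono-≤ lt ⟩
  triangle (a′ + b′)              ≤⟨ m≤m+n (triangle (a′ + b′)) a′ ⟩
  cantor (a′ , b′)                ∎
  where open ≤-Reasoning

cantor-injective : Injective _≡_ _≡_ cantor
cantor-injective {a , b} {a′ , b′} eq with <-cmp (a + b) (a′ + b′)
... | tri< lt _ _ = contradiction eq (<⇒≢ (cantor-< {a} {b} {a′} {b′} lt))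
... | tri> _ _ gt = contradiction (sym eq) (<⇒≢ (cantor-< {a′} {b′} {a} {b} gt))
... | tri≈ _ same _ = cong₂ _,_ a≡a′ (+-cancelˡ-≡ a b b′ (trans same (cong (_+ b′) (sym a≡a′))))
  where
  a≡a′ : a ≡ a′
  a≡a′ = +-cancelˡ-≡ (triangle (a + b)) a a′ (trans eq (cong (λ s → triangle s + a′) (sym same)))

ℕ×ℕ↣ℕ : (ℕ × ℕ) ↣ ℕ
ℕ×ℕ↣ℕ = mk↣ cantor-injective

ℕ⊎ℕ↣ℕ : (ℕ ⊎ ℕ) ↣ ℕ
ℕ⊎ℕ↣ℕ = ℕ×ℕ↣ℕ ↣-∘ mk↣ tag-injective
  where
  tag-injective : Injective _≡_ _≡_ [ (0 ,_) , (1 ,_) ]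
  tag-injective {inj₁ _} {inj₁ _} refl = refl
  tag-injective {inj₂ _} {inj₂ _} refl = refl
  tag-injective {inj₁ _} {inj₂ _} ()
  tag-injective {inj₂ _} {inj₁ _} ()

module _ {m} (A₁ A₂ : PTA m) where

  BoundedlyAmbiguous-∪ : BoundedlyAmbiguous A₁ → BoundedlyAmbiguous A₂ → BoundedlyAmbiguous (A₁ ∪ᴬ A₂)
  BoundedlyAmbiguous-∪ (k₁ , f₁) (k₂ , f₂) =
    k₁ + k₂ , λ t → InjectsInto-↣ {A = A₁ ∪ᴬ A₂} (Union.InjectsInto-∪ A₁ A₂ (f₁ t) (f₂ t)) (↔⇒↣ (↔-sym +↔⊎))

  BoundedlyAmbiguous-∩ : ExcludedMiddle 0ℓ →
    BoundedlyAmbiguous A₁ → BoundedlyAmbiguous A₂ → BoundedlyAmbiguous (A₁ ∩ᴬ A₂)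
  BoundedlyAmbiguous-∩ em (k₁ , f₁) (k₂ , f₂) =
    k₁ * k₂ ,
    λ t → InjectsInto-↣ {A = A₁ ∩ᴬ A₂} (Intersection.InjectsInto-∩ A₁ A₂ em (f₁ t) (f₂ t)) (↔⇒↣ (↔-sym *↔×))

  FinitelyAmbiguous-∪ : FinitelyAmbiguous A₁ → FinitelyAmbiguous A₂ → FinitelyAmbiguous (A₁ ∪ᴬ A₂)
  FinitelyAmbiguous-∪ f₁ f₂ t =
    let (k₁ , g₁) = f₁ t ; (k₂ , g₂) = f₂ t
    in k₁ + k₂ , InjectsInto-↣ {A = A₁ ∪ᴬ A₂} (Union.InjectsInto-∪ A₁ A₂ g₁ g₂) (↔⇒↣ (↔-sym +↔⊎))

  FinitelyAmbiguous-∩ : ExcludedMiddle 0ℓ →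
    FinitelyAmbiguous A₁ → FinitelyAmbiguous A₂ → FinitelyAmbiguous (A₁ ∩ᴬ A₂)
  FinitelyAmbiguous-∩ em f₁ f₂ t =
    let (k₁ , g₁) = f₁ t ; (k₂ , g₂) = f₂ t
    in k₁ * k₂ , InjectsInto-↣ {A = A₁ ∩ᴬ A₂} (Intersection.InjectsInto-∩ A₁ A₂ em g₁ g₂) (↔⇒↣ (↔-sym *↔×))

  CountablyAmbiguous-∪ : CountablyAmbiguous A₁ → CountablyAmbiguous A₂ → CountablyAmbiguous (A₁ ∪ᴬ A₂)
  CountablyAmbiguous-∪ f₁ f₂ t =
    InjectsInto-↣ {A = A₁ ∪ᴬ A₂} (Union.InjectsInto-∪ A₁ A₂ (f₁ t) (f₂ t)) ℕ⊎ℕ↣ℕ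

  CountablyAmbiguous-∩ : ExcludedMiddle 0ℓ →
    CountablyAmbiguous A₁ → CountablyAmbiguous A₂ → CountablyAmbiguous (A₁ ∩ᴬ A₂)
  CountablyAmbiguous-∩ em f₁ f₂ t =
    InjectsInto-↣ {A = A₁ ∩ᴬ A₂} (Intersection.InjectsInto-∩ A₁ A₂ em (f₁ t) (f₂ t)) ℕ×ℕ↣ℕ

  Recognizes-⋃-suc : ∀ {k} {L : Fin (suc k) → Lang m} →
    Recognizes A₁ (L zero) → Recognizes A₂ (⋃ (L ∘ suc)) → Recognizes (A₁ ∪ᴬ A₂) (⋃ L)
  Recognizes-⋃-suc R₁ R₂ t = ⇔-sym (Union.ACC-∪ A₁ A₂) ⇔-∘ ((R₁ t ⊎-⇔ R₂ t) ⇔-∘ ⇔-sym ⊎⇔∃)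

  Recognizes-⋂-suc : ExcludedMiddle 0ℓ → ∀ {k} {L : Fin (suc k) → Lang m} →
    Recognizes A₁ (L zero) → Recognizes A₂ (⋂ (L ∘ suc)) → Recognizes (A₁ ∩ᴬ A₂) (⋂ L)
  Recognizes-⋂-suc em R₁ R₂ t =
    ⇔-sym (Intersection.ACC-∩ A₁ A₂ em) ⇔-∘ ((R₁ t ×-⇔ R₂ t) ⇔-∘ ⇔-sym ∀-cons-⇔)

Recognizes-⋃-zero : ∀ {m} (L : Fin 0 → Lang m) → Recognizes ∅ᴬ (⋃ L)
Recognizes-⋃-zero L t = mk⇔ (λ ()) (λ a → ⊥-elim (¬ACC-∅ {t = t} a))

Recognizes-⋂-zero : ∀ {m} (L : Fin 0 → Lang m) → Recognizes universal (⋂ L)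
Recognizes-⋂-zero L t = mk⇔ (λ _ → ACC-universal t) (λ _ ())

closure : ExcludedMiddle 0ℓ → (Amb : ∀ {m} → PTA m → Set) →
  (∀ {m} → Amb (∅ᴬ {m})) → (∀ {m} → Amb (universal {m})) →
  (∀ {m} (A₁ A₂ : PTA m) → Amb A₁ → Amb A₂ → Amb (A₁ ∪ᴬ A₂)) →
  (∀ {m} (A₁ A₂ : PTA m) → Amb A₁ → Amb A₂ → Amb (A₁ ∩ᴬ A₂)) →
  ClosedUnderFiniteUnionIntersection (λ L → ∃[ A ] (Recognizes A L × Amb A))
closure em Amb Amb-∅ Amb-universal Amb-∪ Amb-∩ m zero L _ =
  (∅ᴬ , Recognizes-⋃-zero L , Amb-∅) , (universal , Recognizes-⋂-zero L , Amb-universal)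
closure em Amb Amb-∅ Amb-universal Amb-∪ Amb-∩ m (suc k) L h =
  let ((B₁ , R-B₁ , amb-B₁) , (B₂ , R-B₂ , amb-B₂)) =
        closure em Amb Amb-∅ Amb-universal Amb-∪ Amb-∩ m k (L ∘ suc) (h ∘ suc)
      (A , R-A , amb-A) = h zero
  in (A ∪ᴬ B₁ , Recognizes-⋃-suc A B₁ R-A R-B₁ , Amb-∪ A B₁ amb-A amb-B₁) ,
     (A ∩ᴬ B₂ , Recognizes-⋂-suc A B₂ em R-A R-B₂ , Amb-∩ A B₂ amb-A amb-B₂)

corollary3p2 : ExcludedMiddle 0ℓ →
    ClosedUnderFiniteUnionIntersection BALang ×
    ClosedUnderFiniteUnionIntersection FALang ×
    ClosedUnderFiniteUnionIntersection CALang
corollary3p2 em =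
  closure em BoundedlyAmbiguous (0 , λ t → InjectsInto-∅ t) (1 , λ t → InjectsInto-universal t zero)
    BoundedlyAmbiguous-∪ (λ A₁ A₂ → BoundedlyAmbiguous-∩ A₁ A₂ em) ,
  closure em FinitelyAmbiguous (λ t → 0 , InjectsInto-∅ t) (λ t → 1 , InjectsInto-universal t zero)
    FinitelyAmbiguous-∪ (λ A₁ A₂ → FinitelyAmbiguous-∩ A₁ A₂ em) ,
  closure em CountablyAmbiguous (λ t → InjectsInto-∅ t) (λ t → InjectsInto-universal t 0)
    CountablyAmbiguous-∪ (λ A₁ A₂ → CountablyAmbiguous-∩ A₁ A₂ em)
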